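{- For any finite posets $P$ and $Q$: (1) $RR(P,Q)\ge (h(P)-1)(h(Q)-1)$; (2) $RR(P,Q)\ge N_{w(P),w(Q)}$; (3) if $h(P)=2$ and $w(Q)\ge 3$ then $RR(P,Q)\ge w(Q)+2$, and if $h(P)=w(Q)=2$, or $h(P)\ge 3$ and $w(Q)\ge 2$, then $RR(P,Q)\ge (h(P)-1)(w(Q)-1)+2$.
   Context: For a positive integer $N$, $\mathcal{B}_N$ denotes the Boolean lattice of all subsets of $[N]=\{1,\dots,N\}$ ordered by inclusion. A family $\mathcal{G}$ of sets is a copy of a poset $P$ if there is a bijection $\phi:P\to\mathcal{G}$ with $x<_P y$ if and only if $\phi(x)\subsetneq\phi(y)$. A coloring of $\mathcal{B}_N$ is any map from $\mathcal{B}_N$ to the positive integers. Under a coloring, a monochromatic $P$ is a copy of $P$ all of whose sets have the same color, and a rainbow $Q$ is a copy of $Q$ whose sets have pairwise distinct colors. $RR(P,Q)$ is the minimum integer $N$ such that every coloring of $\mathcal{B}_N$ contains a monochromatic $P$ or a rainbow $Q$. The height $h(P)$ is the maximum size of a chain in $P$, and the width $w(P)$ is the maximum size of an antichain in $P$. For positive integers $a,b$, $N_{a,b}$ is the minimum integer $N$ such that $\binom{N}{\lfloor N/2\rfloor}\ge (a-1)(b-1)+1$. -}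

module Defs where

open import Level using (0ℓ)
open import Data.Nat using (ℕ; _∸_; _*_; _+_; _≤_; _<_; _/_)
open import Data.Nat.Combinatorics using (_C_)
open import Data.Fin using (Fin)
open import Data.Fin.Subset using (Subset; _∈_; _⊆_; ∣_∣)
open import Data.Product using (Σ; _×_)
open import Data.Sum using (_⊎_)
open import Relation.Nullary using (¬_)
open import Relation.Binary.PropositionalEquality using (_≡_; _≢_)
open import Relation.Binary.Structures using (IsPartialOrder)
open import Function.Definitions using (Injective)

record FinPoset : Set₁ where
  field
    size : ℕ
    _≼_  : Fin size → Fin size → Set
    isPartialOrder : IsPartialOrder _≡_ _≼_

  _≺_ : Fin size → Fin size → Set
  x ≺ y = (x ≼ y) × (x ≢ y)

  IsChain : Subset size → Set
  IsChain S = ∀ x y → x ∈ S → y ∈ S → (x ≼ y) ⊎ (y ≼ x)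

  IsAntichain : Subset size → Set
  IsAntichain S = ∀ x y → x ∈ S → y ∈ S → x ≢ y → ¬ (x ≼ y)

open FinPoset public

IsHeight : FinPoset → ℕ → Set
IsHeight P h = Σ (Subset (size P)) (λ S → IsChain P S × ∣ S ∣ ≡ h)
             × (∀ S → IsChain P S → ∣ S ∣ ≤ h)

IsWidth : FinPoset → ℕ → Set
IsWidth P w = Σ (Subset (size P)) (λ S → IsAntichain P S × ∣ S ∣ ≡ w)
            × (∀ S → IsAntichain P S → ∣ S ∣ ≤ w)

-- Boolean lattice B_N: subsets of [N] (here Fin N), ordered by inclusion.
-- proper inclusion
_⊊_ : ∀ {N} → Subset N → Subset N → Set
A ⊊ B = (A ⊆ B) × (A ≢ B)

IsCopy : (P : FinPoset) (N : ℕ) → (Fin (size P) → Subset N) → Set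
IsCopy P N φ = Injective _≡_ _≡_ φ
             × (∀ x y → (_≺_ P x y → φ x ⊊ φ y) × (φ x ⊊ φ y → _≺_ P x y))

-- colourings of B_N (colours are natural numbers; only equality of colours matters)
Coloring : ℕ → Set
Coloring N = Subset N → ℕ

MonoCopy : (P : FinPoset) (N : ℕ) → Coloring N → Set
MonoCopy P N c = Σ (Fin (size P) → Subset N) λ φ →
  IsCopy P N φ × (∀ x y → c (φ x) ≡ c (φ y))

RainbowCopy : (Q : FinPoset) (N : ℕ) → Coloring N → Set
RainbowCopy Q N c = Σ (Fin (size Q) → Subset N) λ ψ →
  IsCopy Q N ψ × (∀ x y → x ≢ y → c (ψ x) ≢ c (ψ y))

RamseyProp : FinPoset → FinPoset → ℕ → Set
RamseyProp P Q N = (c : Coloring N) → MonoCopy P N c ⊎ RainbowCopy Q N c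

IsRR : FinPoset → FinPoset → ℕ → Set
IsRR P Q r = (1 ≤ r) × RamseyProp P Q r
           × (∀ N → 1 ≤ N → N < r → ¬ RamseyProp P Q N)

NabCond : ℕ → ℕ → ℕ → Set
NabCond a b N = (a ∸ 1) * (b ∸ 1) + 1 ≤ N C (N / 2)

IsNab : ℕ → ℕ → ℕ → Set
IsNab a b n = NabCond a b n × (∀ m → m < n → ¬ NabCond a b m)

-- Each bound is witnessed by a colouring of B_N, for every N below the bound, with neither a
-- monochromatic P nor a rainbow Q; both halves are pigeonhole counts on a longest chain or a largest
-- antichain.
-- (1) Colour A by ⌊|A| / (h(P) − 1)⌋. The sets of a copy of a chain have distinct sizes, so a colour
-- class holds chains of at most h(P) − 1 sets, and there are at most h(Q) − 1 colours.
-- (2) Split B_N into the C(N, ⌊N/2⌋) chains of a symmetric chain decomposition, number them, and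
-- colour a set by ⌊(its chain's number) / (w(P) − 1)⌋. A colour class is covered by w(P) − 1 chains,
-- so contains no antichain of w(P) sets, and there are at most w(Q) − 1 colours.
-- (3) Give ∅ and [N] colours of their own and cut the layers 1, …, N − 1 into at most w(Q) − 1
-- bands of h(P) − 1 consecutive layers. A monochromatic chain stays inside one band, and a rainbow
-- antichain of two or more sets avoids ∅ and [N] and has at most one set per band.
-- When h(P) = 2, colour by size: a rainbow Sperner family of w ≥ 3 sets inside B_N with N ≤ w + 1
-- has a set of every size 1, …, N − 1, and the singleton {e} forces both the (N − 1)-set and a
-- third member to miss e, which puts the third member inside the (N − 1)-set.

module Submission where

open import Defs
open import Data.Nat using (ℕ; _∸_; _*_; _+_; _≤_)
open import Data.Product using (_×_)
open import Data.Sum using (_⊎_)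
open import Relation.Binary.PropositionalEquality using (_≡_)

open import Data.Nat.Base using (zero; suc; _<_; z≤n; s≤s; NonZero; >-nonZero; >-nonZero⁻¹)
open import Data.Nat.Properties
open import Data.Nat.DivMod
  using (_/_; _%_; m≡m%n+[m/n]*n; m%n<n; m<n*o⇒m/o<n; m/n≤m; m*n/n≡m; +-distrib-/-∣ˡ)
open import Data.Nat.Divisibility using (divides-refl)
open import Data.Nat.Combinatorics using (_C_; nCk+nC[k+1]≡[n+1]C[k+1])
open import Data.Fin.Base using (Fin; zero; suc)
open import Data.Fin.Properties using (any?) renaming (_≟_ to _≟ᶠ_)
open import Data.Fin.Subset
  using (Subset; inside; outside; _∈_; _∉_; _⊆_; _-_; ∁; ⊤; ∣_∣; Nonempty)
open import Data.Fin.Subset.Properties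
open import Data.Vec.Base using ([]; _∷_; here; there)
open import Data.Product using (∃; _,_; proj₁; proj₂)
open import Data.Sum using (inj₁; inj₂; [_,_])
open import Data.Empty using (⊥-elim)
open import Function.Base using (_∘_)
open import Relation.Nullary using (¬_; yes; no; contradiction)
open import Relation.Nullary.Decidable using (_×-dec_)
open import Relation.Binary.PropositionalEquality
  using (_≢_; refl; sym; trans; cong; cong₂; subst; module ≡-Reasoning)

private
  variable
    n N : ℕ
    x y : Fin n
    p : Subset n

-- Cardinality of finite subsets and the pigeonhole principle

InjectiveOn : {A : Set} → Subset n → (Fin n → A) → Set
InjectiveOn S f = ∀ {x y} → x ∈ S → y ∈ S → f x ≡ f y → x ≡ y

Comparable : Subset n → Subset n → Set
Comparable p q = p ⊆ q ⊎ q ⊆ p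

x∉p-x : ∀ (p : Subset n) x → x ∉ p - x
x∉p-x (outside ∷ p) zero    ()
x∉p-x (inside  ∷ p) zero    ()
x∉p-x (outside ∷ p) (suc x) (there x∈p-x) = x∉p-x p x x∈p-x
x∉p-x (inside  ∷ p) (suc x) (there x∈p-x) = x∉p-x p x x∈p-x

y∈p-x⇒y≢x : y ∈ p - x → y ≢ x
y∈p-x⇒y≢x {p = p} y∈p-x refl = x∉p-x p _ y∈p-x

y∈p-x⇒y∈p : y ∈ p - x → y ∈ p
y∈p-x⇒y∈p {p = p} = p─q⊆p p _

∣p∣≤1+∣p-x∣ : ∀ (p : Subset n) x → ∣ p ∣ ≤ suc ∣ p - x ∣
∣p∣≤1+∣p-x∣ (outside ∷ p) zero    = subst (λ q → ∣ p ∣ ≤ suc ∣ q ∣) (sym (p─⊥≡p p)) (n≤1+n ∣ p ∣)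
∣p∣≤1+∣p-x∣ (inside  ∷ p) zero    = subst (λ q → suc ∣ p ∣ ≤ suc ∣ q ∣) (sym (p─⊥≡p p)) ≤-refl
∣p∣≤1+∣p-x∣ (outside ∷ p) (suc x) = ∣p∣≤1+∣p-x∣ p x
∣p∣≤1+∣p-x∣ (inside  ∷ p) (suc x) = s≤s (∣p∣≤1+∣p-x∣ p x)

x∈p⇒0<∣p∣ : x ∈ p → 0 < ∣ p ∣
x∈p⇒0<∣p∣ x∈p = ≤-<-trans z≤n (x∈p⇒∣p-x∣<∣p∣ x∈p)

0<∣p∣⇒Nonempty : ∀ (p : Subset n) → 0 < ∣ p ∣ → Nonempty p
0<∣p∣⇒Nonempty {n} p 0<∣p∣ with nonempty? p
... | yes nonempty = nonempty
... | no empty = contradiction (subst (0 <_) (trans (cong ∣_∣ (Empty-unique empty)) (∣⊥∣≡0 n)) 0<∣p∣) n≮0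

∃-other : ∀ (p : Subset n) x → 2 ≤ ∣ p ∣ → ∃ λ y → y ∈ p × y ≢ x
∃-other p x 2≤∣p∣ with 0<∣p∣⇒Nonempty (p - x) (≤-pred (≤-trans 2≤∣p∣ (∣p∣≤1+∣p-x∣ p x)))
... | y , y∈p-x = y , y∈p-x⇒y∈p y∈p-x , y∈p-x⇒y≢x y∈p-x

∣p∣≡1⇒∈-unique : ∣ p ∣ ≡ 1 → x ∈ p → y ∈ p → y ≡ x
∣p∣≡1⇒∈-unique {p = p} {x = x} {y = y} ∣p∣≡1 x∈p y∈p with y ≟ᶠ x
... | yes y≡x = y≡x
... | no y≢x = contradiction
  (subst (1 <_) ∣p∣≡1 (≤-<-trans (x∈p⇒0<∣p∣ {p = p - x} (x∈p∧x≢y⇒x∈p-y y∈p y≢x)) (x∈p⇒∣p-x∣<∣p∣ x∈p)))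
  (<-irrefl refl)

∣p∣≡1∧x∈p∧x∈q⇒p⊆q : ∀ {p q : Subset n} → ∣ p ∣ ≡ 1 → x ∈ p → x ∈ q → p ⊆ q
∣p∣≡1∧x∈p∧x∈q⇒p⊆q {q = q} ∣p∣≡1 x∈p x∈q y∈p =
  subst (_∈ q) (sym (∣p∣≡1⇒∈-unique ∣p∣≡1 x∈p y∈p)) x∈q

∣q∣≡n∸1∧x∉q∧x∉p⇒p⊆q : ∀ {p q : Subset n} → 1 ≤ n → ∣ q ∣ ≡ n ∸ 1 → x ∉ q → x ∉ p → p ⊆ q
∣q∣≡n∸1∧x∉q∧x∉p⇒p⊆q {n} {p = p} {q} 1≤n ∣q∣≡n∸1 x∉q x∉p {y} y∈p with y ∈? q
... | yes y∈q = y∈q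
... | no  y∉q = contradiction
  (subst (_∈ p) (∣p∣≡1⇒∈-unique ∣∁q∣≡1 (x∉p⇒x∈∁p x∉q) (x∉p⇒x∈∁p y∉q)) y∈p) x∉p
  where
  ∣∁q∣≡1 : ∣ ∁ q ∣ ≡ 1
  ∣∁q∣≡1 = trans (∣∁p∣≡n∸∣p∣ q) (trans (cong (n ∸_) ∣q∣≡n∸1) (m∸[m∸n]≡n 1≤n))

∣p∣≡0⇒p⊆q : ∀ {p q : Subset n} → ∣ p ∣ ≡ 0 → p ⊆ q
∣p∣≡0⇒p⊆q ∣p∣≡0 x∈p = contradiction (subst (0 <_) ∣p∣≡0 (x∈p⇒0<∣p∣ x∈p)) n≮0

∣q∣≡n⇒p⊆q : ∀ {p q : Subset n} → ∣ q ∣ ≡ n → p ⊆ q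
∣q∣≡n⇒p⊆q ∣q∣≡n _ = subst (_ ∈_) (sym (∣p∣≡n⇒p≡⊤ ∣q∣≡n)) ∈⊤

p⊊q⇒∣p∣<∣q∣ : ∀ {p q : Subset n} → p ⊊ q → ∣ p ∣ < ∣ q ∣
p⊊q⇒∣p∣<∣q∣ {p = []}          {[]}          (_ , p≢q) = contradiction refl p≢q
p⊊q⇒∣p∣<∣q∣ {p = outside ∷ p} {outside ∷ q} (p⊆q , p≢q) =
  p⊊q⇒∣p∣<∣q∣ (drop-∷-⊆ p⊆q , λ p≡q → p≢q (cong (outside ∷_) p≡q))
p⊊q⇒∣p∣<∣q∣ {p = inside  ∷ p} {inside  ∷ q} (p⊆q , p≢q) =
  s≤s (p⊊q⇒∣p∣<∣q∣ (drop-∷-⊆ p⊆q , λ p≡q → p≢q (cong (inside ∷_) p≡q)))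
p⊊q⇒∣p∣<∣q∣ {p = outside ∷ p} {inside  ∷ q} (p⊆q , _)   = s≤s (p⊆q⇒∣p∣≤∣q∣ (drop-∷-⊆ p⊆q))
p⊊q⇒∣p∣<∣q∣ {p = inside  ∷ p} {outside ∷ q} (p⊆q , _)   with p⊆q here
... | ()

pigeonhole : ∀ m (S : Subset n) (f : Fin n → ℕ) →
             (∀ {x} → x ∈ S → f x < m) → InjectiveOn S f → ∣ S ∣ ≤ m
pigeonhole {n} zero S f f<0 _ with nonempty? S
... | yes (x , x∈S) = contradiction (f<0 x∈S) n≮0
... | no  empty     = ≤-reflexive (trans (cong ∣_∣ (Empty-unique empty)) (∣⊥∣≡0 n))
pigeonhole (suc m) S f f≤m inj with any? (λ x → (x ∈? S) ×-dec (f x ≟ m))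
... | yes (x , x∈S , fx≡m) = ≤-trans (∣p∣≤1+∣p-x∣ S x) (s≤s (pigeonhole m (S - x) f f<m inj′))
  where
  inj′ : InjectiveOn (S - x) f
  inj′ y∈S-x z∈S-x = inj (y∈p-x⇒y∈p y∈S-x) (y∈p-x⇒y∈p z∈S-x)
  f<m : ∀ {y} → y ∈ S - x → f y < m
  f<m y∈S-x = ≤∧≢⇒< (≤-pred (f≤m (y∈p-x⇒y∈p y∈S-x)))
    (λ fy≡m → y∈p-x⇒y≢x y∈S-x (inj (y∈p-x⇒y∈p y∈S-x) x∈S (trans fy≡m (sym fx≡m))))
... | no none = m≤n⇒m≤1+n (pigeonhole m S f f<m inj)
  where
  f<m : ∀ {x} → x ∈ S → f x < m
  f<m x∈S = ≤∧≢⇒< (≤-pred (f≤m x∈S)) (λ fx≡m → none (_ , x∈S , fx≡m))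

pigeonhole-range : ∀ (S : Subset n) (f : Fin n → ℕ) {lo hi} →
                   (∀ {x} → x ∈ S → lo ≤ f x × f x < hi) → InjectiveOn S f → ∣ S ∣ ≤ hi ∸ lo
pigeonhole-range S f {lo} {hi} range inj = pigeonhole (hi ∸ lo) S (λ x → f x ∸ lo)
  (λ x∈S → ∸-monoˡ-< (proj₂ (range x∈S)) (proj₁ (range x∈S)))
  (λ x∈S y∈S eq → inj x∈S y∈S (∸-cancelʳ-≡ (proj₁ (range x∈S)) (proj₁ (range y∈S)) eq))

-- Ranking k-subsets, and a symmetric chain decomposition

nCk≤[1+n]Ck : ∀ n k → n C k ≤ suc n C k
nCk≤[1+n]Ck n zero    = ≤-refl
nCk≤[1+n]Ck n (suc k) = subst (n C suc k ≤_) (nCk+nC[k+1]≡[n+1]C[k+1] n k) (m≤n+m _ _)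

-- The k-subsets of [n] avoiding the first point come first, then those containing it.
rank : Subset n → ℕ → ℕ
rank []            k       = 0
rank (outside ∷ p) k       = rank p k
rank (inside  ∷ p) zero    = 0
rank {suc n} (inside ∷ p) (suc k) = n C suc k + rank p k

rank<C : ∀ (p : Subset n) k → ∣ p ∣ ≡ k → rank p k < n C k
rank<C []            _ refl = s≤s z≤n
rank<C {suc n} (outside ∷ p) k ∣p∣≡k = ≤-trans (rank<C p k ∣p∣≡k) (nCk≤[1+n]Ck n k)
rank<C {suc n} (inside  ∷ p) _ refl = begin-strict
  n C suc ∣ p ∣ + rank p ∣ p ∣ <⟨ +-monoʳ-< (n C suc ∣ p ∣) (rank<C p ∣ p ∣ refl) ⟩
  n C suc ∣ p ∣ + n C ∣ p ∣    ≡⟨ +-comm (n C suc ∣ p ∣) (n C ∣ p ∣) ⟩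
  n C ∣ p ∣ + n C suc ∣ p ∣    ≡⟨ nCk+nC[k+1]≡[n+1]C[k+1] n ∣ p ∣ ⟩
  suc n C suc ∣ p ∣            ∎
  where open ≤-Reasoning

rank-injective : ∀ (p q : Subset n) k → ∣ p ∣ ≡ k → ∣ q ∣ ≡ k → rank p k ≡ rank q k → p ≡ q
rank-injective [] [] _ _ _ _ = refl
rank-injective (outside ∷ p) (outside ∷ q) k ∣p∣≡k ∣q∣≡k eq =
  cong (outside ∷_) (rank-injective p q k ∣p∣≡k ∣q∣≡k eq)
rank-injective {suc n} (inside ∷ p) (inside ∷ q) _ refl ∣q∣≡k eq =
  cong (inside ∷_)
    (rank-injective p q ∣ p ∣ refl (suc-injective ∣q∣≡k) (+-cancelˡ-≡ (n C suc ∣ p ∣) _ _ eq))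
rank-injective {suc n} (outside ∷ p) (inside ∷ q) _ ∣p∣≡k refl eq =
  contradiction (subst (n C suc ∣ q ∣ ≤_) (sym eq) (m≤m+n _ _)) (<⇒≱ (rank<C p _ ∣p∣≡k))
rank-injective {suc n} (inside ∷ p) (outside ∷ q) _ refl ∣q∣≡k eq =
  contradiction (subst (n C suc ∣ p ∣ ≤_) eq (m≤m+n _ _)) (<⇒≱ (rank<C q _ ∣q∣≡k))

-- A ChainCode N l names a chain A₀ ⊂ ⋯ ⊂ A_l of the de Bruijn–Tengbergen–Kruyswijk symmetric
-- chain decomposition of B_N, with A_k = chainAt c k. Adding a new first point 0, a chain of B_N
-- yields the chain A₀ ⊂ ⋯ ⊂ A_l ⊂ A_l ∪ {0} (extend) and A₀ ∪ {0} ⊂ ⋯ ⊂ A_{l-1} ∪ {0} (shift).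
data ChainCode : ℕ → ℕ → Set where
  base   : ChainCode 0 0
  extend : ∀ {N l} → ChainCode N l → ChainCode (suc N) (suc l)
  shift  : ∀ {N l} → ChainCode N (suc l) → ChainCode (suc N) l

shifts : ∀ {N l} → ChainCode N l → ℕ
shifts base       = 0
shifts (extend c) = shifts c
shifts (shift c)  = suc (shifts c)

chainAt : ∀ {N l} → ChainCode N l → ℕ → Subset N
chainAt base k = []
chainAt (extend {l = l} c) k with k ≤? l
... | yes _ = outside ∷ chainAt c k
... | no  _ = inside  ∷ chainAt c l
chainAt (shift c) k = inside ∷ chainAt c k

chainAt-mono : ∀ {N l} (c : ChainCode N l) {k k′} → k ≤ k′ → chainAt c k ⊆ chainAt c k′
chainAt-mono base _ = λ x∈ → x∈
chainAt-mono (extend {l = l} c) {k} {k′} k≤k′ with k ≤? l | k′ ≤? l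
... | yes _   | yes _    = s⊆s (chainAt-mono c k≤k′)
... | yes k≤l | no  _    = out⊆ (chainAt-mono c k≤l)
... | no  k≰l | yes k′≤l = contradiction (≤-trans k≤k′ k′≤l) k≰l
... | no  _   | no  _    = λ x∈ → x∈
chainAt-mono (shift c) k≤k′ = s⊆s (chainAt-mono c k≤k′)

∣chainAt∣ : ∀ {N l} (c : ChainCode N l) k → k ≤ l → ∣ chainAt c k ∣ ≡ shifts c + k
∣chainAt∣ base zero z≤n = refl
∣chainAt∣ (extend {l = l} c) k k≤1+l with k ≤? l
... | yes k≤l = ∣chainAt∣ c k k≤l
... | no  k≰l rewrite ∣chainAt∣ c l ≤-refl | ≤-antisym k≤1+l (≰⇒> k≰l) = sym (+-suc _ l)
∣chainAt∣ (shift c) k k≤l = cong suc (∣chainAt∣ c k (m≤n⇒m≤1+n k≤l))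

N≡shifts*2+l : ∀ {N l} (c : ChainCode N l) → N ≡ shifts c * 2 + l
N≡shifts*2+l base = refl
N≡shifts*2+l (extend {l = l} c) = trans (cong suc (N≡shifts*2+l c)) (sym (+-suc (shifts c * 2) l))
N≡shifts*2+l (shift  {l = l} c) = trans (cong suc (N≡shifts*2+l c)) (cong suc (+-suc (shifts c * 2) l))

record ChainPosition (N : ℕ) : Set where
  constructor _at_
  field
    {length} : ℕ
    code     : ChainCode N length
    index    : ℕ
open ChainPosition

locate-inside : ∀ {N} → ChainPosition N → ChainPosition (suc N)
locate-inside (_at_ {zero} c k) = extend c at 1
locate-inside (_at_ {suc l} c k) with suc l ≤? k
... | yes _ = extend c at suc (suc l)
... | no  _ = shift c at k

locate : Subset N → ChainPosition N
locate [] = base at 0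
locate (outside ∷ p) with locate p
... | c at k = extend c at k
locate (inside ∷ p) = locate-inside (locate p)

locate-sound : ∀ (p : Subset N) →
               index (locate p) ≤ length (locate p) × chainAt (code (locate p)) (index (locate p)) ≡ p
locate-sound [] = z≤n , refl
locate-sound (outside ∷ p) with locate p | locate-sound p
... | _at_ {l} c k | k≤l , refl with k ≤? l
...   | yes _   = m≤n⇒m≤1+n k≤l , refl
...   | no  k≰l = contradiction k≤l k≰l
locate-sound (inside ∷ p) with locate p | locate-sound p
... | _at_ {zero} c zero | _ , refl = ≤-refl , refl
... | _at_ {suc l} c k | k≤1+l , refl with suc l ≤? k
...   | no  1+l≰k = ≤-pred (≰⇒> 1+l≰k) , refl
...   | yes 1+l≤k with suc (suc l) ≤? suc l
...     | yes 2+l≤1+l = contradiction 2+l≤1+l (n≮n _)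
...     | no  _ rewrite ≤-antisym k≤1+l 1+l≤k = ≤-refl , refl

locate-inside-top : ∀ {N l} (c : ChainCode N l) → locate-inside (c at l) ≡ extend c at suc l
locate-inside-top {l = zero} c = refl
locate-inside-top {l = suc l} c with suc l ≤? suc l
... | yes _       = refl
... | no  1+l≰1+l = contradiction ≤-refl 1+l≰1+l

locate-chainAt : ∀ {N l} (c : ChainCode N l) k → k ≤ l → locate (chainAt c k) ≡ c at k
locate-chainAt base zero z≤n = refl
locate-chainAt (extend {l = l} c) k k≤1+l with k ≤? l
... | yes k≤l rewrite locate-chainAt c k k≤l = refl
... | no  k≰l rewrite locate-chainAt c l ≤-refl | ≤-antisym k≤1+l (≰⇒> k≰l) = locate-inside-top c
locate-chainAt (shift {l = l} c) k k≤l rewrite locate-chainAt c k (m≤n⇒m≤1+n k≤l) with suc l ≤? k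
... | yes 1+l≤k = contradiction (≤-trans 1+l≤k k≤l) (n≮n _)
... | no  _     = refl

chainAt-comparable : ∀ {N l} (c : ChainCode N l) k k′ → Comparable (chainAt c k) (chainAt c k′)
chainAt-comparable c k k′ with ≤-total k k′
... | inj₁ k≤k′ = inj₁ (chainAt-mono c k≤k′)
... | inj₂ k′≤k = inj₂ (chainAt-mono c k′≤k)

middle : Subset N → Subset N
middle p = chainAt (code (locate p)) (length (locate p) / 2)

∣middle∣ : ∀ (p : Subset N) → ∣ middle p ∣ ≡ N / 2
∣middle∣ {N} p with locate p
... | _at_ {l} c _ = begin
  ∣ chainAt c (l / 2) ∣        ≡⟨ ∣chainAt∣ c (l / 2) (m/n≤m l 2) ⟩
  shifts c + l / 2             ≡⟨ cong (_+ l / 2) (m*n/n≡m (shifts c) 2) ⟨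
  shifts c * 2 / 2 + l / 2     ≡⟨ +-distrib-/-∣ˡ l (divides-refl (shifts c)) ⟨
  (shifts c * 2 + l) / 2       ≡⟨ cong (_/ 2) (N≡shifts*2+l c) ⟨
  N / 2                        ∎
  where open ≡-Reasoning

middle-≡⇒comparable : ∀ (p q : Subset N) → middle p ≡ middle q → Comparable p q
middle-≡⇒comparable p q eq with locate p | locate-sound p | locate q | locate-sound q
... | _at_ {l} c k | _ , refl | _at_ {l′} c′ k′ | _ , refl with same-position
  where
  same-position : c at (l / 2) ≡ c′ at (l′ / 2)
  same-position = trans (sym (locate-chainAt c (l / 2) (m/n≤m l 2)))
                        (trans (cong locate eq) (locate-chainAt c′ (l′ / 2) (m/n≤m l′ 2)))
...   | refl = chainAt-comparable c k k′

-- Copies of posets in B_N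

Sperner : Subset n → (Fin n → Subset N) → Set
Sperner S F = ∀ {x y} → x ∈ S → y ∈ S → x ≢ y → ¬ F x ⊆ F y

Sperner∧comparable⇒≡ : ∀ {S : Subset n} {F : Fin n → Subset N} → Sperner S F →
                       x ∈ S → y ∈ S → Comparable (F x) (F y) → x ≡ y
Sperner∧comparable⇒≡ {x = x} {y} sperner x∈S y∈S comparable with x ≟ᶠ y
... | yes x≡y = x≡y
... | no  x≢y with comparable
...   | inj₁ Fx⊆Fy = ⊥-elim (sperner x∈S y∈S x≢y Fx⊆Fy)
...   | inj₂ Fy⊆Fx = ⊥-elim (sperner y∈S x∈S (x≢y ∘ sym) Fy⊆Fx)

module _ (P : FinPoset) {φ : Fin (size P) → Subset N} (copy : IsCopy P N φ) where

  copy-antichain-Sperner : ∀ {S} → IsAntichain P S → Sperner S φ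
  copy-antichain-Sperner antichain {x} {y} x∈S y∈S x≢y φx⊆φy = antichain x y x∈S y∈S x≢y
    (proj₁ (proj₂ (proj₂ copy x y) (φx⊆φy , λ φx≡φy → x≢y (proj₁ copy φx≡φy))))

  copy-chain-sizes-injective : ∀ {S} → IsChain P S → InjectiveOn S (λ x → ∣ φ x ∣)
  copy-chain-sizes-injective chain {x} {y} x∈S y∈S ∣φx∣≡∣φy∣ with x ≟ᶠ y
  ... | yes x≡y = x≡y
  ... | no  x≢y with chain x y x∈S y∈S
  ...   | inj₁ x≼y = contradiction ∣φx∣≡∣φy∣
                       (<⇒≢ (p⊊q⇒∣p∣<∣q∣ (proj₁ (proj₂ copy x y) (x≼y , x≢y))))
  ...   | inj₂ y≼x = contradiction (sym ∣φx∣≡∣φy∣)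
                       (<⇒≢ (p⊊q⇒∣p∣<∣q∣ (proj₁ (proj₂ copy y x) (y≼x , x≢y ∘ sym))))

rainbow-injective : ∀ {S : Subset n} {c : Coloring N} {ψ : Fin n → Subset N} →
                    (∀ x y → x ≢ y → c (ψ x) ≢ c (ψ y)) → InjectiveOn S (c ∘ ψ)
rainbow-injective rainbow {x} {y} _ _ eq with x ≟ᶠ y
... | yes x≡y = x≡y
... | no  x≢y = contradiction eq (rainbow x y x≢y)

-- The colourings

Avoids : FinPoset → FinPoset → (N : ℕ) → Coloring N → Set
Avoids P Q N c = ¬ MonoCopy P N c × ¬ RainbowCopy Q N c

avoiding-coloring⇒≤ : ∀ (P Q : FinPoset) {N} b → (N < b → ∃ (Avoids P Q N)) → RamseyProp P Q N → b ≤ N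
avoiding-coloring⇒≤ P Q {N} b avoid ramsey with b ≤? N
... | yes b≤N = b≤N
... | no  b≰N with avoid (≰⇒> b≰N)
...   | c , no-mono , no-rainbow = ⊥-elim ([ no-mono , no-rainbow ] (ramsey c))

n∸1<n : ∀ {n} → 0 < n ∸ 1 → n ∸ 1 < n
n∸1<n {suc n} _ = n<1+n n

/∧%⇒≡ : ∀ {m n} d .{{_ : NonZero d}} → m / d ≡ n / d → m % d ≡ n % d → m ≡ n
/∧%⇒≡ {m} {n} d m/d≡n/d m%d≡n%d = begin
  m                 ≡⟨ m≡m%n+[m/n]*n m d ⟩
  m % d + m / d * d ≡⟨ cong₂ (λ r q → r + q * d) m%d≡n%d m/d≡n/d ⟩
  n % d + n / d * d ≡⟨ m≡m%n+[m/n]*n n d ⟨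
  n                 ∎
  where open ≡-Reasoning

module BlockColoring {N} (κ : Subset N → ℕ) (a b : ℕ) (κ<a*b : ∀ A → κ A < a * b) where

  private
    0<a*b : 0 < a * b
    0<a*b = ≤-<-trans z≤n (κ<a*b ⊤)

  instance
    a≢0 : NonZero a
    a≢0 = m*n≢0⇒m≢0 a {{>-nonZero 0<a*b}}

  0<a : 0 < a
  0<a = >-nonZero⁻¹ a

  0<b : 0 < b
  0<b = >-nonZero⁻¹ b {{m*n≢0⇒n≢0 a {{>-nonZero 0<a*b}}}}

  coloring : Coloring N
  coloring A = κ A / a

  avoids : ∀ (P Q : FinPoset) (SP : Subset (size P)) (SQ : Subset (size Q)) → a < ∣ SP ∣ → b < ∣ SQ ∣ →
           (∀ {φ} → IsCopy P N φ → InjectiveOn SP (κ ∘ φ)) → Avoids P Q N coloring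
  avoids P Q SP SQ a<∣SP∣ b<∣SQ∣ κ-injective = no-mono , no-rainbow
    where
    no-mono : ¬ MonoCopy P N coloring
    no-mono (φ , copy , mono) = <⇒≱ a<∣SP∣ (pigeonhole a SP (λ x → κ (φ x) % a) (λ _ → m%n<n _ a)
      (λ x∈SP y∈SP %≡ → κ-injective copy x∈SP y∈SP (/∧%⇒≡ a (mono _ _) %≡)))
    no-rainbow : ¬ RainbowCopy Q N coloring
    no-rainbow (ψ , _ , rainbow) = <⇒≱ b<∣SQ∣ (pigeonhole b SQ (coloring ∘ ψ)
      (λ {x} _ → m<n*o⇒m/o<n (subst (κ (ψ x) <_) (*-comm a b) (κ<a*b (ψ x))))
      (rainbow-injective {c = coloring} {ψ = ψ} rainbow))

height-bound : ∀ P Q r → RamseyProp P Q r → ∀ hP hQ → IsHeight P hP → IsHeight Q hQ →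
               (hP ∸ 1) * (hQ ∸ 1) ≤ r
height-bound P Q r ramsey _ _ ((SP , chain , refl) , _) ((SQ , _ , refl) , _) =
  avoiding-coloring⇒≤ P Q _ avoid ramsey
  where
  avoid : r < (∣ SP ∣ ∸ 1) * (∣ SQ ∣ ∸ 1) → ∃ (Avoids P Q r)
  avoid r<ab = coloring ,
    avoids P Q SP SQ (n∸1<n 0<a) (n∸1<n 0<b) (λ copy → copy-chain-sizes-injective P copy chain)
    where open BlockColoring ∣_∣ (∣ SP ∣ ∸ 1) (∣ SQ ∣ ∸ 1) (λ A → ≤-<-trans (∣p∣≤n A) r<ab)

width-bound : ∀ P Q r → RamseyProp P Q r → ∀ wP wQ n → IsWidth P wP → IsWidth Q wQ → IsNab wP wQ n → n ≤ r
width-bound P Q r ramsey _ _ n ((SP , antichain , refl) , _) ((SQ , _ , refl) , _) (_ , minimal) =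
  avoiding-coloring⇒≤ P Q n avoid ramsey
  where
  avoid : r < n → ∃ (Avoids P Q r)
  avoid r<n = coloring , avoids P Q SP SQ (n∸1<n 0<a) (n∸1<n 0<b) middle-rank-injective
    where
    C≤ab : r C (r / 2) ≤ (∣ SP ∣ ∸ 1) * (∣ SQ ∣ ∸ 1)
    C≤ab = m<1+n⇒m≤n (subst (r C (r / 2) <_) (+-comm _ 1) (≰⇒> (minimal r r<n)))
    open BlockColoring (λ A → rank (middle A) (r / 2)) (∣ SP ∣ ∸ 1) (∣ SQ ∣ ∸ 1)
      (λ A → <-≤-trans (rank<C (middle A) (r / 2) (∣middle∣ A)) C≤ab)
    middle-rank-injective : ∀ {φ} → IsCopy P r φ → InjectiveOn SP (λ x → rank (middle (φ x)) (r / 2))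
    middle-rank-injective {φ} copy {x} {y} x∈SP y∈SP eq =
      Sperner∧comparable⇒≡ (copy-antichain-Sperner P copy antichain) x∈SP y∈SP
        (middle-≡⇒comparable (φ x) (φ y)
          (rank-injective (middle (φ x)) (middle (φ y)) (r / 2) (∣middle∣ (φ x)) (∣middle∣ (φ y)) eq))

Sperner-interior : ∀ {S : Subset n} {F : Fin n → Subset N} {x} → Sperner S F → 2 ≤ ∣ S ∣ → x ∈ S →
                   0 < ∣ F x ∣ × ∣ F x ∣ < N
Sperner-interior {S = S} {F} {x} sperner 2≤∣S∣ x∈S with ∃-other S x 2≤∣S∣
... | y , y∈S , y≢x =
  n≢0⇒n>0 (λ ∣Fx∣≡0 → sperner x∈S y∈S (y≢x ∘ sym) (∣p∣≡0⇒p⊆q ∣Fx∣≡0)) ,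
  ≤∧≢⇒< (∣p∣≤n (F x)) (λ ∣Fx∣≡N → sperner y∈S x∈S y≢x (∣q∣≡n⇒p⊆q ∣Fx∣≡N))

module Bands (a N : ℕ) .{{_ : NonZero a}} where

  band : ℕ → ℕ
  band zero = 0
  band (suc s) with suc s ≟ N
  ... | yes _ = 1
  ... | no  _ = 2 + s / a

  unband : ℕ → ℕ → ℕ
  unband zero          _ = 0
  unband (suc zero)    _ = N
  unband (suc (suc q)) ρ = suc (ρ + q * a)

  unband-band : ∀ s → unband (band s) ((s ∸ 1) % a) ≡ s
  unband-band zero = refl
  unband-band (suc s) with suc s ≟ N
  ... | yes 1+s≡N = sym 1+s≡N
  ... | no  _     = cong suc (sym (m≡m%n+[m/n]*n s a))

  band-interior : ∀ {s} → 0 < s → s < N → band s ≡ 2 + (s ∸ 1) / a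
  band-interior {suc s} _ s<N with suc s ≟ N
  ... | yes 1+s≡N = contradiction 1+s≡N (<⇒≢ s<N)
  ... | no  _     = refl

s∸1<K : ∀ {s r K} → 0 < s → s < r → r < K + 2 → s ∸ 1 < K
s∸1<K {suc s} {r} {K} _ s<r r<K+2 =
  ≤-pred (≤-pred (≤-trans (s≤s s<r) (subst (suc r ≤_) (+-comm K 2) r<K+2)))

band-bound : ∀ P Q r → RamseyProp P Q r → ∀ hP wQ → IsHeight P hP → IsWidth Q wQ → 2 ≤ hP → 2 ≤ wQ →
             (hP ∸ 1) * (wQ ∸ 1) + 2 ≤ r
band-bound P Q r ramsey _ _ ((SP , chain , refl) , _) ((SQ , antichain , refl) , _) 2≤∣SP∣ 2≤∣SQ∣ =
  avoiding-coloring⇒≤ P Q _ avoid ramsey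
  where
  a b : ℕ
  a = ∣ SP ∣ ∸ 1
  b = ∣ SQ ∣ ∸ 1
  0<a : 0 < a
  0<a = ∸-monoˡ-≤ 1 2≤∣SP∣
  instance
    a≢0 : NonZero a
    a≢0 = >-nonZero 0<a
  open Bands a r
  avoid : r < a * b + 2 → ∃ (Avoids P Q r)
  avoid r<ab+2 = (λ A → band ∣ A ∣) , no-mono , no-rainbow
    where
    no-mono : ¬ MonoCopy P r (λ A → band ∣ A ∣)
    no-mono (φ , copy , mono) = <⇒≱ (n∸1<n 0<a)
      (pigeonhole a SP (λ x → (∣ φ x ∣ ∸ 1) % a) (λ _ → m%n<n _ a) λ {x} {y} x∈SP y∈SP %≡ →
        copy-chain-sizes-injective P copy chain x∈SP y∈SP (begin
          ∣ φ x ∣                                        ≡⟨ unband-band ∣ φ x ∣ ⟨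
          unband (band ∣ φ x ∣) ((∣ φ x ∣ ∸ 1) % a)      ≡⟨ cong₂ unband (mono x y) %≡ ⟩
          unband (band ∣ φ y ∣) ((∣ φ y ∣ ∸ 1) % a)      ≡⟨ unband-band ∣ φ y ∣ ⟩
          ∣ φ y ∣                                        ∎))
      where open ≡-Reasoning
    no-rainbow : ¬ RainbowCopy Q r (λ A → band ∣ A ∣)
    no-rainbow (ψ , copy , rainbow) = <⇒≱ (n∸1<n (∸-monoˡ-≤ 1 2≤∣SQ∣))
      (pigeonhole b SQ (λ x → (∣ ψ x ∣ ∸ 1) / a) bound λ x∈SQ y∈SQ eq →
        rainbow-injective {c = λ A → band ∣ A ∣} {ψ = ψ} rainbow x∈SQ y∈SQ
          (trans (band-of x∈SQ) (trans (cong (2 +_) eq) (sym (band-of y∈SQ)))))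
      where
      interior : ∀ {x} → x ∈ SQ → 0 < ∣ ψ x ∣ × ∣ ψ x ∣ < r
      interior = Sperner-interior (copy-antichain-Sperner Q copy antichain) 2≤∣SQ∣
      band-of : ∀ {x} → x ∈ SQ → band ∣ ψ x ∣ ≡ 2 + (∣ ψ x ∣ ∸ 1) / a
      band-of x∈SQ = band-interior (proj₁ (interior x∈SQ)) (proj₂ (interior x∈SQ))
      bound : ∀ {x} → x ∈ SQ → (∣ ψ x ∣ ∸ 1) / a < b
      bound {x} x∈SQ = m<n*o⇒m/o<n (subst (∣ ψ x ∣ ∸ 1 <_) (*-comm a b)
        (s∸1<K (proj₁ (interior x∈SQ)) (proj₂ (interior x∈SQ)) r<ab+2))

∃-value : ∀ (S : Subset n) (f : Fin n → ℕ) v {lo hi} → InjectiveOn S f → hi ∸ lo < ∣ S ∣ →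
          (∀ {x} → x ∈ S → f x ≢ v → lo ≤ f x × f x < hi) → ∃ λ x → x ∈ S × f x ≡ v
∃-value S f v inj small range with any? (λ x → (x ∈? S) ×-dec (f x ≟ v))
... | yes attained = attained
... | no  missed   = contradiction
  (pigeonhole-range S f (λ x∈S → range x∈S (λ fx≡v → missed (_ , x∈S , fx≡v))) inj) (<⇒≱ small)

singleton-coatom-squeeze : ∀ {p q s : Subset N} → 1 ≤ N → ∣ p ∣ ≡ 1 → ∣ q ∣ ≡ N ∸ 1 →
                           ¬ p ⊆ q → ¬ p ⊆ s → s ⊆ q
singleton-coatom-squeeze {p = p} 1≤N ∣p∣≡1 ∣q∣≡N∸1 p⊈q p⊈s
  with 0<∣p∣⇒Nonempty p (subst (0 <_) (sym ∣p∣≡1) (s≤s z≤n))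
... | e , e∈p = ∣q∣≡n∸1∧x∉q∧x∉p⇒p⊆q 1≤N ∣q∣≡N∸1
  (λ e∈q → p⊈q (∣p∣≡1∧x∈p∧x∈q⇒p⊆q ∣p∣≡1 e∈p e∈q))
  (λ e∈s → p⊈s (∣p∣≡1∧x∈p∧x∈q⇒p⊆q ∣p∣≡1 e∈p e∈s))

Sperner-distinct-sizes-bound : ∀ {S : Subset n} {F : Fin n → Subset N} → Sperner S F →
                               InjectiveOn S (λ x → ∣ F x ∣) → 3 ≤ ∣ S ∣ → ∣ S ∣ + 2 ≤ N
Sperner-distinct-sizes-bound {n} {N} {S} {F} sperner sizes-injective 3≤∣S∣ with ∣ S ∣ + 2 ≤? N
... | yes ∣S∣+2≤N = ∣S∣+2≤N
... | no  ∣S∣+2≰N = squeezed (∃-value S ∣F_∣ 1 sizes-injective N∸2<∣S∣ singleton-range)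
                             (∃-value S ∣F_∣ (N ∸ 1) sizes-injective N∸2<∣S∣′ coatom-range)
  where
  ∣F_∣ : Fin n → ℕ
  ∣F x ∣ = ∣ F x ∣
  interior : ∀ {x} → x ∈ S → 0 < ∣ F x ∣ × ∣ F x ∣ < N
  interior = Sperner-interior sperner (≤-trans (n≤1+n 2) 3≤∣S∣)
  instance
    ∣S∣≢0 : NonZero ∣ S ∣
    ∣S∣≢0 = >-nonZero (≤-trans (s≤s z≤n) 3≤∣S∣)
  N∸2<∣S∣ : N ∸ 2 < ∣ S ∣
  N∸2<∣S∣ = m<n+o⇒m∸n<o N 2 (subst (N <_) (+-comm ∣ S ∣ 2) (≰⇒> ∣S∣+2≰N))
  N∸2<∣S∣′ : N ∸ 1 ∸ 1 < ∣ S ∣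
  N∸2<∣S∣′ = subst (_< ∣ S ∣) (sym (∸-+-assoc N 1 1)) N∸2<∣S∣
  singleton-range : ∀ {x} → x ∈ S → ∣ F x ∣ ≢ 1 → 2 ≤ ∣ F x ∣ × ∣ F x ∣ < N
  singleton-range x∈S ∣Fx∣≢1 = ≤∧≢⇒< (proj₁ (interior x∈S)) (∣Fx∣≢1 ∘ sym) , proj₂ (interior x∈S)
  coatom-range : ∀ {x} → x ∈ S → ∣ F x ∣ ≢ N ∸ 1 → 1 ≤ ∣ F x ∣ × ∣ F x ∣ < N ∸ 1
  coatom-range x∈S ∣Fx∣≢N∸1 = proj₁ (interior x∈S) , ≤∧≢⇒< (∸-monoˡ-≤ 1 (proj₂ (interior x∈S))) ∣Fx∣≢N∸1
  squeezed : (∃ λ x → x ∈ S × ∣ F x ∣ ≡ 1) → (∃ λ y → y ∈ S × ∣ F y ∣ ≡ N ∸ 1) → ∣ S ∣ + 2 ≤ N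
  squeezed (x , x∈S , ∣Fx∣≡1) (y , y∈S , ∣Fy∣≡N∸1)
    with ∃-other (S - x) y (≤-pred (≤-trans 3≤∣S∣ (∣p∣≤1+∣p-x∣ S x)))
  ... | z , z∈S-x , z≢y = ⊥-elim (sperner z∈S y∈S z≢y
        (singleton-coatom-squeeze 1≤N ∣Fx∣≡1 ∣Fy∣≡N∸1 (sperner x∈S y∈S x≢y) (sperner x∈S z∈S (z≢x ∘ sym))))
    where
    z∈S = y∈p-x⇒y∈p z∈S-x
    z≢x = y∈p-x⇒y≢x z∈S-x
    1≤N : 1 ≤ N
    1≤N = <-trans (proj₁ (interior x∈S)) (proj₂ (interior x∈S))
    x≢y : x ≢ y
    x≢y refl = <⇒≢ (≤-trans (n≤1+n 2) (≤-trans 3≤∣S∣ (pigeonhole-range S ∣F_∣ interior sizes-injective)))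
                   (trans (sym ∣Fx∣≡1) ∣Fy∣≡N∸1)

height-two-bound : ∀ P Q r → RamseyProp P Q r → ∀ w → IsHeight P 2 → IsWidth Q w → 3 ≤ w → w + 2 ≤ r
height-two-bound P Q r ramsey _ ((SP , chain , ∣SP∣≡2) , _) ((SQ , antichain , refl) , _) 3≤∣SQ∣ =
  avoiding-coloring⇒≤ P Q _ (λ r<∣SQ∣+2 → ∣_∣ , no-mono , no-rainbow r<∣SQ∣+2) ramsey
  where
  no-mono : ¬ MonoCopy P r ∣_∣
  no-mono (φ , copy , mono) = <⇒≱ (subst (1 <_) (sym ∣SP∣≡2) ≤-refl)
    (pigeonhole 1 SP (λ _ → 0) (λ _ → s≤s z≤n)
      (λ x∈SP y∈SP _ → copy-chain-sizes-injective P copy chain x∈SP y∈SP (mono _ _)))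
  no-rainbow : r < ∣ SQ ∣ + 2 → ¬ RainbowCopy Q r ∣_∣
  no-rainbow r<∣SQ∣+2 (ψ , copy , rainbow) = <⇒≱ r<∣SQ∣+2
    (Sperner-distinct-sizes-bound (copy-antichain-Sperner Q copy antichain)
      (rainbow-injective {c = ∣_∣} {ψ = ψ} rainbow) 3≤∣SQ∣)

mainTheorem8 : (P Q : FinPoset) (r : ℕ) → IsRR P Q r →
      (∀ hP hQ → IsHeight P hP → IsHeight Q hQ → (hP ∸ 1) * (hQ ∸ 1) ≤ r)
    × (∀ wP wQ n → IsWidth P wP → IsWidth Q wQ → IsNab wP wQ n → n ≤ r)
    × (∀ hP wQ → IsHeight P hP → IsWidth Q wQ →
         (hP ≡ 2 → 3 ≤ wQ → wQ + 2 ≤ r)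
       × ((hP ≡ 2 × wQ ≡ 2) ⊎ (3 ≤ hP × 2 ≤ wQ) → (hP ∸ 1) * (wQ ∸ 1) + 2 ≤ r))
mainTheorem8 P Q r (_ , ramsey , _) =
  height-bound P Q r ramsey ,
  width-bound P Q r ramsey ,
  λ hP wQ height width →
    (λ { refl 3≤wQ → height-two-bound P Q r ramsey wQ height width 3≤wQ }) ,
    λ { (inj₁ (refl , refl))   → band-bound P Q r ramsey hP wQ height width ≤-refl ≤-refl
      ; (inj₂ (3≤hP , 2≤wQ)) → band-bound P Q r ramsey hP wQ height width (≤-trans (n≤1+n 2) 3≤hP) 2≤wQ }
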